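{- Let $\mathcal D$ be a finite non-empty set. For every formula $\varphi$ of $\mathrm{MSO}_{\mathcal D}$, $\mathrm{MSO}_{\mathcal D}\vdash\varphi\leftrightarrow\varphi^R$.
   Context: $\mathrm{MSO}_{\mathcal D}$: two-sorted classical theory with Individual variables $x,y,z$, Individual terms $t::=x\mid\mathsf{Root}\mid\mathsf S_d(t)$ ($d\in\mathcal D$), monadic Predicate variables $X,Y$, formulas $X(t)\mid t\doteq u\mid t<u\mid\varphi\lor\psi\mid\neg\varphi\mid\exists x\varphi\mid\exists X\varphi$. Provability: classical natural deduction for two-sorted first-order logic, with axioms: equality ($\forall x\,x\doteq x$, $\forall x\forall y(x\doteq y\to\varphi[x/z]\to\varphi[y/z])$); tree axioms $\neg\exists x\bigvee_{d\ne d'}\mathsf S_d(x)\doteq\mathsf S_{d'}(x)$, $\forall x\forall y\bigwedge_d(\mathsf S_d(x)\doteq\mathsf S_d(y)\to x\doteq y)$, $\neg\exists x\,x<x$, transitivity of $<$, $\forall x\,\mathsf{Root}\le x$, $\forall x\forall y\bigwedge_d(x<\mathsf S_d(y)\leftrightarrow x\le y)$ (with $t\le u:=t<u\lor t\doteq u$); comprehension $\exists X\forall y(X(y)\leftrightarrow\varphi)$ ($X$ not free in $\varphi$); induction $\forall X(X(\mathsf{Root})\to\bigwedge_d\forall y(X(y)\to X(\mathsf S_d(y)))\to\forall yX(y))$. Let $\mathrm{FSucc}_d(x,y):=(\mathsf S_d(x)\doteq y)$. For a term $t$ and variable $z$, define $(z\circeq t)$: $(z\circeq y):=(z\doteq y)$;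 $(z\circeq\mathsf{Root}):=\neg\exists z'\bigvee_{d\in\mathcal D}\mathrm{FSucc}_d(z',z)$; $(z\circeq\mathsf S_d(t)):=\exists z'(z'\circeq t\land\mathrm{FSucc}_d(z',z))$. Then $\varphi^R$ is obtained from $\varphi$ by replacing each atomic formula $X(t)$ where $t$ is not a variable by $\exists z((z\circeq t)\land X(z))$ with $z$ fresh. -}

module Defs where

open import Data.Nat using (ℕ; zero; suc)
open import Data.Fin using (Fin; zero; suc; _≟_)
open import Data.List using (List; []; _∷_; map; concatMap; allFin)
open import Data.List.Membership.Propositional using (_∈_)
open import Data.Product using (_×_; _,_)
open import Function using (id; _∘_)
open import Relation.Nullary using (yes; no)

-- MSO_D with D = Fin (suc n): an arbitrary finite non-empty set (up to bijection).
-- Well-scoped de Bruijn syntax: Formula m k has at most m free individual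
-- variables and k free (monadic) predicate variables.
module MSO (n : ℕ) where

  D : Set
  D = Fin (suc n)

  allD : List D
  allD = allFin (suc n)

  distinctPairs : List (D × D)
  distinctPairs = concatMap (λ d → concatMap (λ d' → pick d d') allD) allD
    where
    pick : D → D → List (D × D)
    pick d d' with d ≟ d'
    ... | yes _ = []
    ... | no _  = (d , d') ∷ []

  data Term (m : ℕ) : Set where
    var  : Fin m → Term m
    Root : Term m
    S    : D → Term m → Term m

  infix  6 _≐_ _≺_
  infixr 5 _∨_
  infix  7 ¬_

  data Formula (m k : ℕ) : Set where
    P   : Fin k → Term m → Formula m k
    _≐_ : Term m → Term m → Formula m k
    _≺_ : Term m → Term m → Formula m k
    _∨_ : Formula m k → Formula m k → Formula m k
    ¬_  : Formula m k → Formula m k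
    ∃₁  : Formula (suc m) k → Formula m k
    ∃₂  : Formula m (suc k) → Formula m k

  renT : ∀ {m m'} → (Fin m → Fin m') → Term m → Term m'
  renT ρ (var x) = var (ρ x)
  renT ρ Root    = Root
  renT ρ (S d t) = S d (renT ρ t)

  liftR : ∀ {m m'} → (Fin m → Fin m') → Fin (suc m) → Fin (suc m')
  liftR ρ zero    = zero
  liftR ρ (suc i) = suc (ρ i)

  ren : ∀ {m m' k} → (Fin m → Fin m') → Formula m k → Formula m' k
  ren ρ (P X t)  = P X (renT ρ t)
  ren ρ (t ≐ u)  = renT ρ t ≐ renT ρ u
  ren ρ (t ≺ u)  = renT ρ t ≺ renT ρ u
  ren ρ (φ ∨ ψ)  = ren ρ φ ∨ ren ρ ψ
  ren ρ (¬ φ)    = ¬ ren ρ φ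
  ren ρ (∃₁ φ)   = ∃₁ (ren (liftR ρ) φ)
  ren ρ (∃₂ φ)   = ∃₂ (ren ρ φ)

  substT : ∀ {m m'} → (Fin m → Term m') → Term m → Term m'
  substT σ (var x) = σ x
  substT σ Root    = Root
  substT σ (S d t) = S d (substT σ t)

  liftS : ∀ {m m'} → (Fin m → Term m') → Fin (suc m) → Term (suc m')
  liftS σ zero    = var zero
  liftS σ (suc i) = renT suc (σ i)

  subst : ∀ {m m' k} → (Fin m → Term m') → Formula m k → Formula m' k
  subst σ (P X t)  = P X (substT σ t)
  subst σ (t ≐ u)  = substT σ t ≐ substT σ u
  subst σ (t ≺ u)  = substT σ t ≺ substT σ u
  subst σ (φ ∨ ψ)  = subst σ φ ∨ subst σ ψ
  subst σ (¬ φ)    = ¬ subst σ φ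
  subst σ (∃₁ φ)   = ∃₁ (subst (liftS σ) φ)
  subst σ (∃₂ φ)   = ∃₂ (subst σ φ)

  sub0 : ∀ {m} → Term m → Fin (suc m) → Term m
  sub0 t zero    = t
  sub0 t (suc i) = var i

  _[_] : ∀ {m k} → Formula (suc m) k → Term m → Formula m k
  φ [ t ] = subst (sub0 t) φ

  renP : ∀ {m k k'} → (Fin k → Fin k') → Formula m k → Formula m k'
  renP π (P X t)  = P (π X) t
  renP π (t ≐ u)  = t ≐ u
  renP π (t ≺ u)  = t ≺ u
  renP π (φ ∨ ψ)  = renP π φ ∨ renP π ψ
  renP π (¬ φ)    = ¬ renP π φ
  renP π (∃₁ φ)   = ∃₁ (renP π φ)
  renP π (∃₂ φ)   = ∃₂ (renP (liftR π) φ)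

  infixr 4 _∧_
  infixr 3 _⇒_
  infix  2 _⇔_

  _∧_ : ∀ {m k} → Formula m k → Formula m k → Formula m k
  φ ∧ ψ = ¬ (¬ φ ∨ ¬ ψ)

  _⇒_ : ∀ {m k} → Formula m k → Formula m k → Formula m k
  φ ⇒ ψ = ¬ φ ∨ ψ

  _⇔_ : ∀ {m k} → Formula m k → Formula m k → Formula m k
  φ ⇔ ψ = (φ ⇒ ψ) ∧ (ψ ⇒ φ)

  ∀₁ : ∀ {m k} → Formula (suc m) k → Formula m k
  ∀₁ φ = ¬ ∃₁ (¬ φ)

  ∀₂ : ∀ {m k} → Formula m (suc k) → Formula m k
  ∀₂ φ = ¬ ∃₂ (¬ φ)

  _≼_ : ∀ {m k} → Term m → Term m → Formula m k
  t ≼ u = (t ≺ u) ∨ (t ≐ u)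

  ⊤f ⊥f : ∀ {m k} → Formula m k
  ⊤f = (Root ≐ Root) ∨ ¬ (Root ≐ Root)
  ⊥f = ¬ ⊤f

  ⋁ ⋀ : ∀ {m k} → List (Formula m k) → Formula m k
  ⋁ []           = ⊥f
  ⋁ (φ ∷ [])     = φ
  ⋁ (φ ∷ ψ ∷ φs) = φ ∨ ⋁ (ψ ∷ φs)
  ⋀ []           = ⊤f
  ⋀ (φ ∷ [])     = φ
  ⋀ (φ ∷ ψ ∷ φs) = φ ∧ ⋀ (ψ ∷ φs)

  v0 : ∀ {m} → Term (suc m)
  v0 = var zero

  v1 : ∀ {m} → Term (suc (suc m))
  v1 = var (suc zero)

  wk2 : ∀ {m} → Fin m → Fin (suc (suc m))
  wk2 i = suc (suc i)

  wk : ∀ {m k} → Formula m k → Formula (suc m) k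
  wk = ren suc

  data Axiom {m k : ℕ} : Formula m k → Set where
    eq-refl  : Axiom (∀₁ (v0 ≐ v0))
    -- ∀x∀y (x ≐ y → φ[x/z] → φ[y/z]); z is variable 0 of φ,
    -- under the binders x = v1, y = v0
    eq-subst : (φ : Formula (suc m) k) →
      Axiom (∀₁ (∀₁ (v1 ≐ v0 ⇒
        subst (sub0 v1 ∘ liftR wk2) φ ⇒
        subst (sub0 v0 ∘ liftR wk2) φ)))
    succ-distinct : Axiom (¬ ∃₁ (⋁ (map (λ { (d , d') → S d v0 ≐ S d' v0 }) distinctPairs)))
    succ-inj : Axiom (∀₁ (∀₁ (⋀ (map (λ d → (S d v1 ≐ S d v0) ⇒ (v1 ≐ v0)) allD))))
    lt-irrefl : Axiom (¬ ∃₁ (v0 ≺ v0))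
    lt-trans : Axiom (∀₁ (∀₁ (∀₁ ((var (suc (suc zero)) ≺ v1) ∧ (v1 ≺ v0) ⇒ (var (suc (suc zero)) ≺ v0)))))
    root-min : Axiom (∀₁ (Root ≼ v0))
    lt-succ : Axiom (∀₁ (∀₁ (⋀ (map (λ d → (v1 ≺ S d v0) ⇔ (v1 ≼ v0)) allD))))
    -- ∃X ∀y (X(y) ↔ φ), X not free in φ; y is variable 0 of φ
    comprehension : (φ : Formula (suc m) k) →
      Axiom (∃₂ (∀₁ (P zero v0 ⇔ renP suc φ)))
    induction : Axiom (∀₂ (P zero Root ⇒
      ⋀ (map (λ d → ∀₁ (P zero v0 ⇒ P zero (S d v0))) allD) ⇒
      ∀₁ (P zero v0)))

  infix 1 _⊢_
  data _⊢_ {m k : ℕ} (Γ : List (Formula m k)) : Formula m k → Set where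
    hyp  : ∀ {φ} → φ ∈ Γ → Γ ⊢ φ
    ax   : ∀ {φ} → Axiom φ → Γ ⊢ φ
    ∨I₁  : ∀ {φ ψ} → Γ ⊢ φ → Γ ⊢ φ ∨ ψ
    ∨I₂  : ∀ {φ ψ} → Γ ⊢ ψ → Γ ⊢ φ ∨ ψ
    ∨E   : ∀ {φ ψ χ} → Γ ⊢ φ ∨ ψ → (φ ∷ Γ) ⊢ χ → (ψ ∷ Γ) ⊢ χ → Γ ⊢ χ
    ¬I   : ∀ {φ ψ} → (φ ∷ Γ) ⊢ ψ → (φ ∷ Γ) ⊢ ¬ ψ → Γ ⊢ ¬ φ
    ¬E   : ∀ {φ ψ} → Γ ⊢ φ → Γ ⊢ ¬ φ → Γ ⊢ ψ
    ¬¬E  : ∀ {φ} → Γ ⊢ ¬ ¬ φ → Γ ⊢ φ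
    ∃₁I  : ∀ {φ} (t : Term m) → Γ ⊢ φ [ t ] → Γ ⊢ ∃₁ φ
    ∃₁E  : ∀ {φ χ} → Γ ⊢ ∃₁ φ → _⊢_ {suc m} {k} (φ ∷ map wk Γ) (wk χ) → Γ ⊢ χ
    ∃₂I  : ∀ {φ} (X : Fin k) → Γ ⊢ renP (λ { zero → X ; (suc i) → i }) φ → Γ ⊢ ∃₂ φ
    ∃₂E  : ∀ {φ χ} → Γ ⊢ ∃₂ φ → _⊢_ {m} {suc k} (φ ∷ map (renP suc) Γ) (renP suc χ) → Γ ⊢ χ

  FSucc : ∀ {m k} → D → Term m → Term m → Formula m k
  FSucc d x y = S d x ≐ y

  -- eqR ρ z t  is  (z ≗ ρ t)
  eqR : ∀ {m m' k} → (Fin m → Fin m') → Fin m' → Term m → Formula m' k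
  eqR ρ z (var y) = var z ≐ var (ρ y)
  eqR ρ z Root    = ¬ ∃₁ (⋁ (map (λ d → FSucc d v0 (var (suc z))) allD))
  eqR ρ z (S d t) = ∃₁ (eqR (suc ∘ ρ) zero t ∧ FSucc d v0 (var (suc z)))

  _≗_ : ∀ {m k} → Fin m → Term m → Formula m k
  z ≗ t = eqR id z t

  _^R : ∀ {m k} → Formula m k → Formula m k
  P X (var x) ^R = P X (var x)
  P X t       ^R = ∃₁ ((zero ≗ renT suc t) ∧ P X v0)
  (t ≐ u) ^R = t ≐ u
  (t ≺ u) ^R = t ≺ u
  (φ ∨ ψ) ^R = φ ^R ∨ ψ ^R
  (¬ φ)   ^R = ¬ (φ ^R)
  ∃₁ φ    ^R = ∃₁ (φ ^R)
  ∃₂ φ    ^R = ∃₂ (φ ^R)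

-- φ^R only replaces atoms X(t), t not a variable, by ∃z ((z ≗ t) ∧ X(z)).
-- Provable equivalence is a congruence for every connective and quantifier,
-- so it suffices that z ≗ t is provably equivalent to z ≐ t, and by
-- induction on t everything reduces to the root: z ≗ Root says that z is
-- not a successor. The root is not a successor, since it lies below every
-- node while y < S_d(y); conversely every node is the root or a successor,
-- by the induction axiom applied to the set of such nodes, which exists by
-- comprehension.
module Submission where

open import Defs
open import Data.Nat using (ℕ; zero; suc)
open import Data.Fin using (Fin; zero; suc)
open import Data.List using (List; []; _∷_; map)
open import Data.List.Relation.Unary.Any using (here; there)
open import Data.List.Membership.Propositional using (_∈_)
open import Data.List.Membership.Propositional.Properties using (∈-map⁺; ∈-allFin)
open import Data.List.Relation.Binary.Subset.Propositional using (_⊆_)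
open import Data.List.Relation.Binary.Subset.Propositional.Properties using (map⁺; ∷⁺ʳ)
open import Relation.Binary.PropositionalEquality using (_≡_; refl; sym; trans; cong; cong₂)
open import Function using (_∘_; id)

module _ (n : ℕ) where
  open MSO n

  private variable
    a b m k k' : ℕ
    t u : Term m
    φ ψ χ φ' ψ' : Formula m k
    Γ Δ : List (Formula m k)

  renT-id : (t : Term a) → renT id t ≡ t
  renT-id (var x) = refl
  renT-id Root    = refl
  renT-id (S d t) = cong (S d) (renT-id t)

  renT-renT : (ρ' : Fin b → Fin m) (ρ : Fin a → Fin b) (t : Term a) →
    renT ρ' (renT ρ t) ≡ renT (ρ' ∘ ρ) t
  renT-renT ρ' ρ (var x) = refl
  renT-renT ρ' ρ Root    = refl
  renT-renT ρ' ρ (S d t) = cong (S d) (renT-renT ρ' ρ t)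

  substT-renT : (σ : Fin b → Term m) (ρ : Fin a → Fin b) (t : Term a) →
    substT σ (renT ρ t) ≡ substT (σ ∘ ρ) t
  substT-renT σ ρ (var x) = refl
  substT-renT σ ρ Root    = refl
  substT-renT σ ρ (S d t) = cong (S d) (substT-renT σ ρ t)

  renT-substT : (ρ : Fin b → Fin m) (σ : Fin a → Term b) (t : Term a) →
    renT ρ (substT σ t) ≡ substT (renT ρ ∘ σ) t
  renT-substT ρ σ (var x) = refl
  renT-substT ρ σ Root    = refl
  renT-substT ρ σ (S d t) = cong (S d) (renT-substT ρ σ t)

  substT-renT-inverse : (σ : Fin b → Term a) (ρ : Fin a → Fin b) →
    (∀ i → σ (ρ i) ≡ var i) → (t : Term a) → substT σ (renT ρ t) ≡ t
  substT-renT-inverse σ ρ inv (var x) = inv x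
  substT-renT-inverse σ ρ inv Root    = refl
  substT-renT-inverse σ ρ inv (S d t) = cong (S d) (substT-renT-inverse σ ρ inv t)

  substT-sub0-renT-suc : (u : Term m) (t : Term m) → substT (sub0 u) (renT suc t) ≡ t
  substT-sub0-renT-suc u = substT-renT-inverse (sub0 u) suc (λ _ → refl)

  substT-substT : (σ : Fin b → Term m) (τ : Fin a → Term b) (υ : Fin a → Term m) →
    (∀ i → substT σ (τ i) ≡ υ i) → (t : Term a) → substT σ (substT τ t) ≡ substT υ t
  substT-substT σ τ υ eq (var x) = eq x
  substT-substT σ τ υ eq Root    = refl
  substT-substT σ τ υ eq (S d t) = cong (S d) (substT-substT σ τ υ eq t)

  subst-subst : (σ : Fin b → Term m) (τ : Fin a → Term b) (υ : Fin a → Term m) →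
    (∀ i → substT σ (τ i) ≡ υ i) → (φ : Formula a k) → subst σ (subst τ φ) ≡ subst υ φ
  subst-subst σ τ υ eq (P X t) = cong (P X) (substT-substT σ τ υ eq t)
  subst-subst σ τ υ eq (t ≐ u) = cong₂ _≐_ (substT-substT σ τ υ eq t) (substT-substT σ τ υ eq u)
  subst-subst σ τ υ eq (t ≺ u) = cong₂ _≺_ (substT-substT σ τ υ eq t) (substT-substT σ τ υ eq u)
  subst-subst σ τ υ eq (φ ∨ ψ) = cong₂ _∨_ (subst-subst σ τ υ eq φ) (subst-subst σ τ υ eq ψ)
  subst-subst σ τ υ eq (¬ φ)   = cong ¬_ (subst-subst σ τ υ eq φ)
  subst-subst σ τ υ eq (∃₁ φ)  = cong ∃₁ (subst-subst (liftS σ) (liftS τ) (liftS υ) lifted φ)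
    where
    lifted : ∀ i → substT (liftS σ) (liftS τ i) ≡ liftS υ i
    lifted zero    = refl
    lifted (suc i) = trans (substT-renT (liftS σ) suc (τ i))
                       (trans (sym (renT-substT suc σ (τ i))) (cong (renT suc) (eq i)))
  subst-subst σ τ υ eq (∃₂ φ)  = cong ∃₂ (subst-subst σ τ υ eq φ)

  subst-ren-inverse : (σ : Fin b → Term a) (ρ : Fin a → Fin b) →
    (∀ i → σ (ρ i) ≡ var i) → (φ : Formula a k) → subst σ (ren ρ φ) ≡ φ
  subst-ren-inverse σ ρ inv (P X t) = cong (P X) (substT-renT-inverse σ ρ inv t)
  subst-ren-inverse σ ρ inv (t ≐ u) =
    cong₂ _≐_ (substT-renT-inverse σ ρ inv t) (substT-renT-inverse σ ρ inv u)
  subst-ren-inverse σ ρ inv (t ≺ u) =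
    cong₂ _≺_ (substT-renT-inverse σ ρ inv t) (substT-renT-inverse σ ρ inv u)
  subst-ren-inverse σ ρ inv (φ ∨ ψ) =
    cong₂ _∨_ (subst-ren-inverse σ ρ inv φ) (subst-ren-inverse σ ρ inv ψ)
  subst-ren-inverse σ ρ inv (¬ φ)   = cong ¬_ (subst-ren-inverse σ ρ inv φ)
  subst-ren-inverse σ ρ inv (∃₁ φ)  = cong ∃₁ (subst-ren-inverse (liftS σ) (liftR ρ) lifted φ)
    where
    lifted : ∀ i → liftS σ (liftR ρ i) ≡ var i
    lifted zero    = refl
    lifted (suc i) = cong (renT suc) (inv i)
  subst-ren-inverse σ ρ inv (∃₂ φ)  = cong ∃₂ (subst-ren-inverse σ ρ inv φ)

  ren-liftR-suc-[v0] : (φ : Formula (suc m) k) → ren (liftR suc) φ [ v0 ] ≡ φ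
  ren-liftR-suc-[v0] = subst-ren-inverse (sub0 v0) (liftR suc) (λ { zero → refl ; (suc i) → refl })

  renP-inverse : (π' : Fin k' → Fin k) (π : Fin k → Fin k') →
    (∀ i → π' (π i) ≡ i) → (φ : Formula m k) → renP π' (renP π φ) ≡ φ
  renP-inverse π' π inv (P X t) = cong (λ Y → P Y t) (inv X)
  renP-inverse π' π inv (t ≐ u) = refl
  renP-inverse π' π inv (t ≺ u) = refl
  renP-inverse π' π inv (φ ∨ ψ) = cong₂ _∨_ (renP-inverse π' π inv φ) (renP-inverse π' π inv ψ)
  renP-inverse π' π inv (¬ φ)   = cong ¬_ (renP-inverse π' π inv φ)
  renP-inverse π' π inv (∃₁ φ)  = cong ∃₁ (renP-inverse π' π inv φ)
  renP-inverse π' π inv (∃₂ φ)  = cong ∃₂ (renP-inverse (liftR π') (liftR π) lifted φ)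
    where
    lifted : ∀ i → liftR π' (liftR π i) ≡ i
    lifted zero    = refl
    lifted (suc i) = cong suc (inv i)

  ⋁-map-hom : (F : Formula a k → Formula b k') →
    (∀ φ ψ → F (φ ∨ ψ) ≡ (F φ ∨ F ψ)) → F ⊥f ≡ ⊥f →
    {A : Set} {f : A → Formula a k} {g : A → Formula b k'} →
    (∀ x → F (f x) ≡ g x) → (xs : List A) → F (⋁ (map f xs)) ≡ ⋁ (map g xs)
  ⋁-map-hom F hom-∨ hom-⊥ eq []           = hom-⊥
  ⋁-map-hom F hom-∨ hom-⊥ eq (x ∷ [])     = eq x
  ⋁-map-hom F hom-∨ hom-⊥ eq (x ∷ y ∷ xs) =
    trans (hom-∨ _ _) (cong₂ _∨_ (eq x) (⋁-map-hom F hom-∨ hom-⊥ eq (y ∷ xs)))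

  ⋀-map-hom : (F : Formula a k → Formula b k') →
    (∀ φ ψ → F (φ ∧ ψ) ≡ (F φ ∧ F ψ)) → F ⊤f ≡ ⊤f →
    {A : Set} {f : A → Formula a k} {g : A → Formula b k'} →
    (∀ x → F (f x) ≡ g x) → (xs : List A) → F (⋀ (map f xs)) ≡ ⋀ (map g xs)
  ⋀-map-hom F hom-∧ hom-⊤ eq []           = hom-⊤
  ⋀-map-hom F hom-∧ hom-⊤ eq (x ∷ [])     = eq x
  ⋀-map-hom F hom-∧ hom-⊤ eq (x ∷ y ∷ xs) =
    trans (hom-∧ _ _) (cong₂ _∧_ (eq x) (⋀-map-hom F hom-∧ hom-⊤ eq (y ∷ xs)))

  cast : φ ≡ ψ → Γ ⊢ φ → Γ ⊢ ψ
  cast refl p = p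

  weaken : Γ ⊆ Δ → Γ ⊢ φ → Δ ⊢ φ
  weaken s (hyp p)     = hyp (s p)
  weaken s (ax α)      = ax α
  weaken s (∨I₁ p)     = ∨I₁ (weaken s p)
  weaken s (∨I₂ p)     = ∨I₂ (weaken s p)
  weaken s (∨E p q r)  = ∨E (weaken s p) (weaken (∷⁺ʳ _ s) q) (weaken (∷⁺ʳ _ s) r)
  weaken s (¬I p q)    = ¬I (weaken (∷⁺ʳ _ s) p) (weaken (∷⁺ʳ _ s) q)
  weaken s (¬E p q)    = ¬E (weaken s p) (weaken s q)
  weaken s (¬¬E p)     = ¬¬E (weaken s p)
  weaken s (∃₁I t p)   = ∃₁I t (weaken s p)
  weaken s (∃₁E p q)   = ∃₁E (weaken s p) (weaken (∷⁺ʳ _ (map⁺ wk s)) q)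
  weaken s (∃₂I X p)   = ∃₂I X (weaken s p)
  weaken s (∃₂E p q)   = ∃₂E (weaken s p) (weaken (∷⁺ʳ _ (map⁺ (renP suc) s)) q)

  hyp₀ : (φ ∷ Γ) ⊢ φ
  hyp₀ = hyp (here refl)

  hyp₁ : (ψ ∷ φ ∷ Γ) ⊢ φ
  hyp₁ = hyp (there (here refl))

  ⊤I : Γ ⊢ ⊤f
  ⊤I = ¬¬E (¬I (∨I₂ (¬I (∨I₁ hyp₀) (weaken there hyp₀))) hyp₀)

  ¬I⊥ : (φ ∷ Γ) ⊢ ⊥f → Γ ⊢ ¬ φ
  ¬I⊥ = ¬I ⊤I

  ⊥E : Γ ⊢ ⊥f → Γ ⊢ φ
  ⊥E = ¬E ⊤I

  RAA : (¬ φ ∷ Γ) ⊢ ⊥f → Γ ⊢ φ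
  RAA p = ¬¬E (¬I⊥ p)

  LEM : Γ ⊢ φ ∨ ¬ φ
  LEM = RAA (¬E (∨I₂ (¬I⊥ (¬E (∨I₁ hyp₀) (weaken there hyp₀)))) hyp₀)

  ⇒I : (φ ∷ Γ) ⊢ ψ → Γ ⊢ φ ⇒ ψ
  ⇒I p = ∨E LEM (∨I₂ p) (∨I₁ hyp₀)

  ⇒E : Γ ⊢ φ ⇒ ψ → Γ ⊢ φ → Γ ⊢ ψ
  ⇒E p q = ∨E p (⊥E (¬E (weaken there q) hyp₀)) hyp₀

  cut : Γ ⊢ φ → (φ ∷ Γ) ⊢ ψ → Γ ⊢ ψ
  cut p q = ⇒E (⇒I q) p

  ∧I : Γ ⊢ φ → Γ ⊢ ψ → Γ ⊢ φ ∧ ψ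
  ∧I p q = ¬I⊥ (∨E hyp₀ (¬E (weaken (there ∘ there) p) hyp₀) (¬E (weaken (there ∘ there) q) hyp₀))

  ∧E₁ : Γ ⊢ φ ∧ ψ → Γ ⊢ φ
  ∧E₁ p = RAA (¬E (∨I₁ hyp₀) (weaken there p))

  ∧E₂ : Γ ⊢ φ ∧ ψ → Γ ⊢ ψ
  ∧E₂ p = RAA (¬E (∨I₂ hyp₀) (weaken there p))

  ⇔I : (φ ∷ Γ) ⊢ ψ → (ψ ∷ Γ) ⊢ φ → Γ ⊢ φ ⇔ ψ
  ⇔I p q = ∧I (⇒I p) (⇒I q)

  ⇔E₁ : Γ ⊢ φ ⇔ ψ → Γ ⊢ φ → Γ ⊢ ψ
  ⇔E₁ p = ⇒E (∧E₁ p)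

  ⇔E₂ : Γ ⊢ φ ⇔ ψ → Γ ⊢ ψ → Γ ⊢ φ
  ⇔E₂ p = ⇒E (∧E₂ p)

  ∀I : map wk Γ ⊢ ψ → Γ ⊢ ∀₁ ψ
  ∀I p = ¬I⊥ (∃₁E hyp₀ (¬E (weaken (there ∘ there) p) hyp₀))

  ∀E : Γ ⊢ ∀₁ ψ → (t : Term _) → Γ ⊢ ψ [ t ]
  ∀E p t = RAA (¬E (∃₁I t hyp₀) (weaken there p))

  ∀E₀ : ∀₁ ψ ∈ Γ → map wk Γ ⊢ ψ
  ∀E₀ {ψ = ψ} p = cast (ren-liftR-suc-[v0] ψ) (∀E (hyp (∈-map⁺ wk p)) v0)

  ∃₁I₀ : Δ ⊢ ψ → Δ ⊢ wk (∃₁ ψ)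
  ∃₁I₀ {ψ = ψ} p = ∃₁I v0 (cast (sym (ren-liftR-suc-[v0] ψ)) p)

  ∃₂I₀ : Δ ⊢ ψ → Δ ⊢ renP suc (∃₂ ψ)
  ∃₂I₀ {ψ = ψ} p =
    ∃₂I zero (cast (sym (renP-inverse _ (liftR suc) (λ { zero → refl ; (suc i) → refl }) ψ)) p)

  ⋀I : {A : Set} (f : A → Formula m k) (xs : List A) → (∀ x → Γ ⊢ f x) → Γ ⊢ ⋀ (map f xs)
  ⋀I f []           p = ⊤I
  ⋀I f (x ∷ [])     p = p x
  ⋀I f (x ∷ y ∷ xs) p = ∧I (p x) (⋀I f (y ∷ xs) p)

  ⋀E : {A : Set} (f : A → Formula m k) (xs : List A) {x : A} →
    Γ ⊢ ⋀ (map f xs) → x ∈ xs → Γ ⊢ f x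
  ⋀E f (x ∷ [])     p (here refl) = p
  ⋀E f (x ∷ y ∷ xs) p (here refl) = ∧E₁ p
  ⋀E f (x ∷ y ∷ xs) p (there q)   = ⋀E f (y ∷ xs) (∧E₂ p) q

  ⋁I : {A : Set} (f : A → Formula m k) (xs : List A) {x : A} →
    x ∈ xs → Γ ⊢ f x → Γ ⊢ ⋁ (map f xs)
  ⋁I f (x ∷ [])     (here refl) p = p
  ⋁I f (x ∷ y ∷ xs) (here refl) p = ∨I₁ p
  ⋁I f (x ∷ y ∷ xs) (there q)   p = ∨I₂ (⋁I f (y ∷ xs) q p)

  ⋁E : {A : Set} (f : A → Formula m k) (xs : List A) →
    Γ ⊢ ⋁ (map f xs) → (∀ x → (f x ∷ Γ) ⊢ χ) → Γ ⊢ χ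
  ⋁E f []           p q = ⊥E p
  ⋁E f (x ∷ [])     p q = cut p (q x)
  ⋁E f (x ∷ y ∷ xs) p q = ∨E p (q x) (⋁E f (y ∷ xs) hyp₀ (λ z → weaken (∷⁺ʳ _ there) (q z)))

  infix 2 _⟺_
  _⟺_ : Formula m k → Formula m k → Set
  φ ⟺ ψ = ∀ {Γ} → Γ ⊢ φ ⇔ ψ

  ⟺-refl : φ ⟺ φ
  ⟺-refl = ⇔I hyp₀ hyp₀

  ∨-cong : φ ⟺ φ' → ψ ⟺ ψ' → (φ ∨ ψ) ⟺ (φ' ∨ ψ')
  ∨-cong e f = ⇔I (∨E hyp₀ (∨I₁ (⇔E₁ e hyp₀)) (∨I₂ (⇔E₁ f hyp₀)))
                  (∨E hyp₀ (∨I₁ (⇔E₂ e hyp₀)) (∨I₂ (⇔E₂ f hyp₀)))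

  ¬-cong : φ ⟺ ψ → (¬ φ) ⟺ (¬ ψ)
  ¬-cong e = ⇔I (¬I⊥ (¬E (⇔E₂ e hyp₀) hyp₁)) (¬I⊥ (¬E (⇔E₁ e hyp₀) hyp₁))

  ∃₁-cong : φ ⟺ ψ → ∃₁ φ ⟺ ∃₁ ψ
  ∃₁-cong e = ⇔I (∃₁E hyp₀ (∃₁I₀ (⇔E₁ e hyp₀))) (∃₁E hyp₀ (∃₁I₀ (⇔E₂ e hyp₀)))

  ∃₂-cong : φ ⟺ ψ → ∃₂ φ ⟺ ∃₂ ψ
  ∃₂-cong e = ⇔I (∃₂E hyp₀ (∃₂I₀ (⇔E₁ e hyp₀))) (∃₂E hyp₀ (∃₂I₀ (⇔E₂ e hyp₀)))

  ≐-refl : Γ ⊢ t ≐ t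
  ≐-refl {t = t} = ∀E (ax eq-refl) t

  eq-subst-at : (ψ : Formula (suc m) k) (t u : Term m) →
    subst (sub0 u) (subst (liftS (sub0 t))
      (v1 ≐ v0 ⇒ subst (sub0 v1 ∘ liftR wk2) ψ ⇒ subst (sub0 v0 ∘ liftR wk2) ψ))
    ≡ (t ≐ u ⇒ ψ [ t ] ⇒ ψ [ u ])
  eq-subst-at {m = m} ψ t u =
    cong₂ (λ w φ → (w ≐ u) ⇒ φ) (substT-sub0-renT-suc u t)
      (cong₂ _⇒_ (at v1 t (substT-sub0-renT-suc u t)) (at v0 u refl))
    where
    at : (z : Term (suc (suc m))) (w : Term m) → substT (sub0 u) (substT (liftS (sub0 t)) z) ≡ w →
      subst (sub0 u) (subst (liftS (sub0 t)) (subst (sub0 z ∘ liftR wk2) ψ)) ≡ ψ [ w ]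
    at z w eq = trans (cong (subst (sub0 u)) (subst-subst _ _ _ (λ _ → refl) ψ))
                      (subst-subst _ _ _ (λ { zero → eq ; (suc i) → refl }) ψ)

  ≐-subst : (ψ : Formula (suc m) k) {t u : Term m} → Γ ⊢ t ≐ u → Γ ⊢ ψ [ t ] → Γ ⊢ ψ [ u ]
  ≐-subst ψ {t} {u} t≐u ψt =
    ⇒E (⇒E (cast (eq-subst-at ψ t u) (∀E (∀E (ax (eq-subst ψ)) t) u)) t≐u) ψt

  ≐-sym : Γ ⊢ t ≐ u → Γ ⊢ u ≐ t
  ≐-sym {t = t} {u} t≐u = cast (cong (u ≐_) (substT-sub0-renT-suc u t))
    (≐-subst (v0 ≐ renT suc t) t≐u (cast (cong (t ≐_) (sym (substT-sub0-renT-suc t t))) ≐-refl))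

  ≐-trans : {t u w : Term m} → Γ ⊢ t ≐ u → Γ ⊢ u ≐ w → Γ ⊢ t ≐ w
  ≐-trans {t = t} {u} {w} t≐u u≐w = cast (cong (_≐ w) (substT-sub0-renT-suc w t))
    (≐-subst (renT suc t ≐ v0) u≐w (cast (cong (_≐ u) (sym (substT-sub0-renT-suc u t))) t≐u))

  ≐-cong-S : (d : D) → Γ ⊢ t ≐ u → Γ ⊢ S d t ≐ S d u
  ≐-cong-S {t = t} {u} d t≐u = cast (cong (λ w → S d w ≐ S d u) (substT-sub0-renT-suc u t))
    (≐-subst (renT suc (S d t) ≐ S d v0) t≐u
      (cast (cong (λ w → S d w ≐ S d t) (sym (substT-sub0-renT-suc t t))) ≐-refl))

  fresh-≐ : (t : Term m) → (v0 ≐ renT suc t ∷ map wk Γ) ⊢ wk χ → Γ ⊢ χ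
  fresh-≐ t = ∃₁E (∃₁I t (cast (cong (t ≐_) (sym (substT-sub0-renT-suc t t))) ≐-refl))

  IsSucc : Term m → Formula m k
  IsSucc t = ∃₁ (⋁ (map (λ d → S d v0 ≐ renT suc t) allD))

  RootOrSucc : Term m → Formula m k
  RootOrSucc t = (t ≐ Root) ∨ IsSucc t

  subst-IsSucc : (σ : Fin a → Term b) (t : Term a) →
    subst σ (IsSucc {k = k} t) ≡ IsSucc (substT σ t)
  subst-IsSucc σ t = cong ∃₁ (⋁-map-hom (subst (liftS σ)) (λ _ _ → refl) refl
    (λ d → cong (S d v0 ≐_) (trans (substT-renT (liftS σ) suc t) (sym (renT-substT suc σ t)))) allD)

  ren-IsSucc : (ρ : Fin a → Fin b) (t : Term a) → ren ρ (IsSucc {k = k} t) ≡ IsSucc (renT ρ t)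
  ren-IsSucc ρ t = cong ∃₁ (⋁-map-hom (ren (liftR ρ)) (λ _ _ → refl) refl
    (λ d → cong (S d v0 ≐_) (trans (renT-renT (liftR ρ) suc t) (sym (renT-renT suc ρ t)))) allD)

  renP-IsSucc : (π : Fin k → Fin k') (t : Term m) → renP π (IsSucc t) ≡ IsSucc t
  renP-IsSucc π t = cong ∃₁ (⋁-map-hom (renP π) (λ _ _ → refl) refl (λ _ → refl) allD)

  subst-RootOrSucc : (σ : Fin a → Term b) (t : Term a) →
    subst σ (RootOrSucc {k = k} t) ≡ RootOrSucc (substT σ t)
  subst-RootOrSucc σ t = cong (substT σ t ≐ Root ∨_) (subst-IsSucc σ t)

  ren-RootOrSucc : (ρ : Fin a → Fin b) (t : Term a) →
    ren ρ (RootOrSucc {k = k} t) ≡ RootOrSucc (renT ρ t)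
  ren-RootOrSucc ρ t = cong (renT ρ t ≐ Root ∨_) (ren-IsSucc ρ t)

  renP-RootOrSucc : (π : Fin k → Fin k') (t : Term m) → renP π (RootOrSucc t) ≡ RootOrSucc t
  renP-RootOrSucc π t = cong (t ≐ Root ∨_) (renP-IsSucc π t)

  S-IsSucc : (d : D) (t : Term m) → Γ ⊢ IsSucc (S d t)
  S-IsSucc d t = ∃₁I t (cast (sym (⋁-map-hom (subst (sub0 t)) (λ _ _ → refl) refl
    (λ d' → cong (S d' t ≐_) (substT-sub0-renT-suc t (S d t))) allD))
    (⋁I _ allD (∈-allFin d) ≐-refl))

  lt-succ-at : (x : Fin m) → Γ ⊢ ⋀ (map (λ d → (var x ≺ S d (var x)) ⇔ (var x ≼ var x)) allD)
  lt-succ-at x = cast (⋀-map-hom (subst (sub0 (var x)) ∘ subst (liftS (sub0 (var x))))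
    (λ _ _ → refl) refl (λ _ → refl) allD) (∀E (∀E (ax lt-succ) (var x)) (var x))

  ≺-S : (d : D) (x : Fin m) → Γ ⊢ var x ≺ S d (var x)
  ≺-S d x = ⇔E₂ (⋀E _ allD (lt-succ-at x) (∈-allFin d)) (∨I₂ ≐-refl)

  ≺-Root-absurd : (x : Fin m) → Γ ⊢ var x ≺ Root → Γ ⊢ ⊥f
  ≺-Root-absurd x x≺Root = ∨E (∀E (ax root-min) (var x))
    (¬E (⇒E (∀E (∀E (∀E (ax lt-trans) (var x)) Root) (var x)) (∧I (weaken there x≺Root) hyp₀))
      ≺-irrefl)
    (¬E (≐-subst (var (suc x) ≺ v0) hyp₀ (weaken there x≺Root)) ≺-irrefl)
    where
    ≺-irrefl : Δ ⊢ ¬ (var x ≺ var x)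
    ≺-irrefl = ¬I⊥ (¬E (∃₁I {φ = v0 ≺ v0} (var x) hyp₀) (ax lt-irrefl))

  Root-not-succ : Γ ⊢ ¬ IsSucc Root
  Root-not-succ = ¬I⊥ (∃₁E hyp₀ (⋁E _ allD hyp₀ λ d →
    ≺-Root-absurd zero (≐-subst (var (suc zero) ≺ v0) hyp₀ (≺-S d zero))))

  induction-at : (X : Fin k) →
    Γ ⊢ P X Root ⇒ ⋀ (map (λ d → ∀₁ (P X v0 ⇒ P X (S d v0))) allD) ⇒ ∀₁ (P X v0)
  induction-at X = RAA (¬E (∃₂I X (cast (cong (λ steps → ¬ (P X Root ⇒ steps ⇒ ∀₁ (P X v0)))
    (sym (⋀-map-hom (renP _) (λ _ _ → refl) refl (λ _ → refl) allD))) hyp₀)) (ax induction))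

  defines-RootOrSucc⇒all : {Γ : List (Formula m k)} {X : Fin k} →
    ∀₁ (P X v0 ⇔ RootOrSucc v0) ∈ Γ → Γ ⊢ ∀₁ (P X v0)
  defines-RootOrSucc⇒all {Γ = Γ} {X} def = ⇒E (⇒E (induction-at X) base) (⋀I _ allD step)
    where
    base : Γ ⊢ P X Root
    base = ⇔E₂ (∀E (hyp def) Root) (∨I₁ ≐-refl)
    def-wk : map wk Γ ⊢ ∀₁ (P X v0 ⇔ RootOrSucc v0)
    def-wk = cast (cong (λ φ → ∀₁ (P X v0 ⇔ φ)) (ren-RootOrSucc _ v0)) (hyp (∈-map⁺ wk def))
    -- A successor satisfies RootOrSucc outright.
    step : ∀ d → Γ ⊢ ∀₁ (P X v0 ⇒ P X (S d v0))
    step d = ∀I (⇒I (weaken there (⇔E₂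
      (cast (cong (P X (S d v0) ⇔_) (subst-RootOrSucc _ v0)) (∀E def-wk (S d v0)))
      (∨I₂ (S-IsSucc d v0)))))

  root-or-succ : {Γ : List (Formula m k)} → Γ ⊢ ∀₁ (RootOrSucc v0)
  root-or-succ {m} {k} = ∃₂E (ax (comprehension (RootOrSucc v0)))
    (cast (cong ∀₁ (sym (renP-RootOrSucc suc v0)))
      (cut (defines-RootOrSucc⇒all (here def))
        (∀I (⇔E₁ (∀E₀ (there (here def))) (∀E₀ (here refl))))))
    where
    def : _≡_ {A = Formula m (suc k)}
      (∀₁ (P zero v0 ⇔ RootOrSucc v0)) (∀₁ (P zero v0 ⇔ renP suc (RootOrSucc v0)))
    def = cong (λ φ → ∀₁ (P zero v0 ⇔ φ)) (sym (renP-RootOrSucc suc v0))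

  ¬IsSucc⟺≐Root : {m k : ℕ} (t : Term m) → ¬ IsSucc {k = k} t ⟺ (t ≐ Root)
  ¬IsSucc⟺≐Root {m} t = ⇔I
    (∨E (cast (subst-RootOrSucc _ v0) (∀E root-or-succ t)) hyp₀ (⊥E (¬E hyp₀ hyp₁)))
    (cast (subst-IsSucc-¬ t) (≐-subst (¬ IsSucc v0) (≐-sym hyp₀)
      (cast (sym (subst-IsSucc-¬ Root)) Root-not-succ)))
    where
    subst-IsSucc-¬ : (u : Term m) → (¬ IsSucc v0) [ u ] ≡ ¬ IsSucc u
    subst-IsSucc-¬ u = cong ¬_ (subst-IsSucc _ v0)

  eqR-correct : (ρ : Fin a → Fin m) (z : Fin m) (t : Term a) →
    eqR {k = k} ρ z t ⟺ (var z ≐ renT ρ t)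
  eqR-correct ρ z (var y) = ⟺-refl
  eqR-correct ρ z Root    = ¬IsSucc⟺≐Root (var z)
  eqR-correct ρ z (S d t) = ⇔I
    (∃₁E hyp₀ (cast (cong (λ w → var (suc z) ≐ S d w) (sym (renT-renT suc ρ t)))
      (≐-trans (≐-sym (∧E₂ hyp₀)) (≐-cong-S d (⇔E₁ (eqR-correct (suc ∘ ρ) zero t) (∧E₁ hyp₀))))))
    (fresh-≐ (renT ρ t) (∃₁I₀ (∧I
      (⇔E₂ (eqR-correct (suc ∘ ρ) zero t) (cast (cong (v0 ≐_) (renT-renT suc ρ t)) hyp₀))
      (≐-trans (≐-cong-S d hyp₀) (≐-sym hyp₁)))))

  ≗-correct : (z : Fin m) (t : Term m) → _≗_ {k = k} z t ⟺ (var z ≐ t)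
  ≗-correct z t = cast (cong (λ w → (z ≗ t) ⇔ (var z ≐ w)) (renT-id t)) (eqR-correct id z t)

  atom-R : (X : Fin k) (t : Term m) → P X t ⟺ ∃₁ ((zero ≗ renT suc t) ∧ P X v0)
  atom-R X t = ⇔I
    (fresh-≐ t (∃₁I₀ (∧I (⇔E₂ (≗-correct zero (renT suc t)) hyp₀)
                          (≐-subst (P X v0) (≐-sym hyp₀) hyp₁))))
    (∃₁E hyp₀ (≐-subst (P X v0) (⇔E₁ (≗-correct zero (renT suc t)) (∧E₁ hyp₀)) (∧E₂ hyp₀)))

  ^R-correct : (φ : Formula m k) → φ ⟺ (φ ^R)
  ^R-correct (P X (var x)) = ⟺-refl
  ^R-correct (P X Root)    = atom-R X Root
  ^R-correct (P X (S d t)) = atom-R X (S d t)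
  ^R-correct (t ≐ u)       = ⟺-refl
  ^R-correct (t ≺ u)       = ⟺-refl
  ^R-correct (φ ∨ ψ)       = ∨-cong (^R-correct φ) (^R-correct ψ)
  ^R-correct (¬ φ)         = ¬-cong (^R-correct φ)
  ^R-correct (∃₁ φ)        = ∃₁-cong (^R-correct φ)
  ^R-correct (∃₂ φ)        = ∃₂-cong (^R-correct φ)

lemma8p6 : (n m k : ℕ) (φ : MSO.Formula n m k) →
    MSO._⊢_ n [] (MSO._⇔_ n φ (MSO._^R n φ))
lemma8p6 n m k φ = ^R-correct n φ
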